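{- Let $p\ge3$ be an integer, $u$ an integer coprime to $p$, and $r_1$ the integer with $0<r_1<p$ and $ur_1\equiv1\pmod p$. Put $r_0=p$ and for $1\le i\le t$ define integers $Z_i$, $r_{i+1}$ by $r_{i-1}=Z_ir_i+r_{i+1}$, $0\le r_{i+1}<r_i$, where $t$ is the index with $r_t=1$. Define $s_0=0$, $s_1=1$ and $s_{i+1}=Z_is_i+s_{i-1}$ for $1\le i\le t$. Let $\mathcal{Z}$ be the set of integer $t$-tuples $\mathbf z=(z_1,\dots,z_t)$ with $0\le z_i\le Z_i$ for all $i$, which are either $\mathbf 0$ or satisfy: (i) the smallest index $i$ with $z_i>0$ is odd, and (ii) $0\le z_t\le Z_t-1$. Then for every $\mathbf z\in\mathcal{Z}$, $$\Big\langle u\sum_{1\le i\le t}z_i(-1)^{i-1}r_i\Big\rangle_p=\sum_{1\le i\le t}z_is_i.$$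
   Context: $\langle x\rangle_p$ denotes the least nonnegative residue of the integer $x$ modulo $p$. -}

module Defs where

open import Data.Nat as ℕ using (ℕ; zero; suc; NonZero)
open import Data.Integer as ℤ using (ℤ; +_; -_)

sumℕ : ℕ → (ℕ → ℕ) → ℕ
sumℕ zero    f = 0
sumℕ (suc t) f = sumℕ t f ℕ.+ f (suc t)

sumℤ : ℕ → (ℕ → ℤ) → ℤ
sumℤ zero    f = + 0
sumℤ (suc t) f = sumℤ t f ℤ.+ f (suc t)

sSeq : (ℕ → ℕ) → ℕ → ℕ
sSeq Z zero          = 0
sSeq Z (suc zero)    = 1
sSeq Z (suc (suc i)) = Z (suc i) ℕ.* sSeq Z (suc i) ℕ.+ sSeq Z i

{-# OPTIONS --safe #-}
-- With εₙ = (-1)ⁿ, the remainders εₙ rₙ₊₁ obey, up to sign, the same recurrence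
-- as the continuants sₙ₊₁, so u εₙ rₙ₊₁ ≡ sₙ₊₁ (mod p) by induction from u r₀ ≡ 0 and
-- u r₁ ≡ 1; summing gives the congruence.  The right-hand side is already the least
-- residue: rₙ sₙ₊₁ + rₙ₊₁ sₙ = r₀ for all n, so sₜ₊₁ = p, while Σ Zᵢ sᵢ = sₜ₊₁ + sₜ - 1
-- together with zᵢ ≤ Zᵢ and zₜ < Zₜ bounds Σ zᵢ sᵢ by sₜ₊₁ - 1.
module Submission where

open import Defs
open import Data.Nat as ℕ using (ℕ; zero; suc; NonZero; _≤_; _<_)
open import Data.Nat.Coprimality using (Coprime)
open import Data.Nat.DivMod using (_%_)
open import Data.Integer as ℤ using (ℤ; +_; -_; ∣_∣)
open import Data.Integer.Divisibility using (_∣_)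
open import Data.Integer.DivMod using (_%ℕ_)
open import Data.Product using (Σ; _×_)
open import Data.Sum using (_⊎_)
open import Relation.Binary.PropositionalEquality using (_≡_)

open import Data.Integer using (_+_; _*_; _-_; _^_; 0ℤ; 1ℤ; -1ℤ)
open import Data.Integer.DivMod using (_/ℕ_; a≡a%ℕn+[a/ℕn]*n; n%ℕd<d)
open import Data.Integer.Divisibility.Signed as Signed
  using (divides; ∣m⇒∣-m; ∣m∣n⇒∣m+n; ∣n⇒∣m*n; ∣⇒∣ᵤ; ∣ᵤ⇒∣)
import Data.Integer.Properties as ℤ
open import Data.Integer.Tactic.RingSolver using (solve-∀)
import Data.Nat.Properties as ℕ
open import Data.Nat.Divisibility using (n∣m⇒m%n≡0)
open import Data.Nat.DivMod using (m<n⇒m%n≡m)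
import Data.Nat.Tactic.RingSolver as ℕ-Solver
open import Data.Product using (_,_; proj₁; proj₂)
open import Data.Sum using ([_,_]′)
open import Function using (_$_; _∘_)
open import Level using (0ℓ)
open import Relation.Binary.Bundles using (Setoid)
open import Relation.Binary.Structures using (IsEquivalence)
import Relation.Binary.Reasoning.Setoid as SetoidReasoning
open import Relation.Binary.PropositionalEquality
  using (refl; sym; trans; cong; cong₂; subst; module ≡-Reasoning)

-- A record rather than an abbreviation of  + p ∣ x - y  so that x and y are inferable.
infix 4 _≡_[mod_]
record _≡_[mod_] (x y : ℤ) (p : ℕ) : Set where
  constructor ∣⇒≡[mod]
  field ≡[mod]⇒∣ : + p Signed.∣ x - y

open _≡_[mod_]

module _ {p : ℕ} where

  ≡⇒≡[mod] : ∀ {x y} → x ≡ y → x ≡ y [mod p ]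
  ≡⇒≡[mod] {x} refl = ∣⇒≡[mod] (divides 0ℤ (ℤ.+-inverseʳ x))

  ≡[mod]-sym : ∀ {x y} → x ≡ y [mod p ] → y ≡ x [mod p ]
  ≡[mod]-sym {x} {y} (∣⇒≡[mod] p∣x-y) =
    ∣⇒≡[mod] $ subst (+ p Signed.∣_) (negate x y) (∣m⇒∣-m p∣x-y)
    where
    negate : ∀ x y → - (x - y) ≡ y - x
    negate = solve-∀

  ≡[mod]-trans : ∀ {x y z} → x ≡ y [mod p ] → y ≡ z [mod p ] → x ≡ z [mod p ]
  ≡[mod]-trans {x} {y} {z} (∣⇒≡[mod] p∣x-y) (∣⇒≡[mod] p∣y-z) =
    ∣⇒≡[mod] $ subst (+ p Signed.∣_) (telescope x y z) (∣m∣n⇒∣m+n p∣x-y p∣y-z)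
    where
    telescope : ∀ x y z → (x - y) + (y - z) ≡ x - z
    telescope = solve-∀

  ≡[mod]-isEquivalence : IsEquivalence (_≡_[mod p ])
  ≡[mod]-isEquivalence = record
    { refl = ≡⇒≡[mod] refl ; sym = ≡[mod]-sym ; trans = ≡[mod]-trans }

  +-cong-mod : ∀ {x y v w} → x ≡ y [mod p ] → v ≡ w [mod p ] → x + v ≡ y + w [mod p ]
  +-cong-mod {x} {y} {v} {w} (∣⇒≡[mod] p∣x-y) (∣⇒≡[mod] p∣v-w) =
    ∣⇒≡[mod] $ subst (+ p Signed.∣_) (interchange x y v w) (∣m∣n⇒∣m+n p∣x-y p∣v-w)
    where
    interchange : ∀ x y v w → (x - y) + (v - w) ≡ (x + v) - (y + w)
    interchange = solve-∀

  *-congˡ-mod : ∀ c {x y} → x ≡ y [mod p ] → c * x ≡ c * y [mod p ]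
  *-congˡ-mod c {x} {y} (∣⇒≡[mod] p∣x-y) =
    ∣⇒≡[mod] $ subst (+ p Signed.∣_) (distrib c x y) (∣n⇒∣m*n c p∣x-y)
    where
    distrib : ∀ c x y → c * (x - y) ≡ c * x - c * y
    distrib = solve-∀

  neg-cong-mod : ∀ {x y} → x ≡ y [mod p ] → - x ≡ - y [mod p ]
  neg-cong-mod {x} {y} (∣⇒≡[mod] p∣x-y) =
    ∣⇒≡[mod] $ subst (+ p Signed.∣_) (distrib x y) (∣m⇒∣-m p∣x-y)
    where
    distrib : ∀ x y → - (x - y) ≡ - x - - y
    distrib = solve-∀

≡[mod]-setoid : ℕ → Setoid 0ℓ 0ℓ
≡[mod]-setoid p = record { isEquivalence = ≡[mod]-isEquivalence {p} }

module ≡[mod]-Reasoning (p : ℕ) = SetoidReasoning (≡[mod]-setoid p)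

≡[mod]⇒≡ : ∀ {p a b} .{{_ : NonZero p}} → + a ≡ + b [mod p ] → a < p → b < p → a ≡ b
≡[mod]⇒≡ {p} {a} {b} a≡b a<p b<p =
  ℤ.+-injective (ℤ.i-j≡0⇒i≡j (+ a) (+ b) (ℤ.∣i∣≡0⇒i≡0 ∣a-b∣≡0))
  where
  ∣a-b∣<p : ∣ + a - + b ∣ < p
  ∣a-b∣<p = ℕ.≤-<-trans (ℕ.≤-reflexive (cong ∣_∣ (ℤ.[+m]-[+n]≡m⊖n a b)))
              (ℕ.≤-<-trans (ℤ.∣m⊝n∣≤m⊔n a b) (ℕ.⊔-pres-<m a<p b<p))
  ∣a-b∣≡0 : ∣ + a - + b ∣ ≡ 0
  ∣a-b∣≡0 = trans (sym (m<n⇒m%n≡m ∣a-b∣<p)) (n∣m⇒m%n≡0 _ p (∣⇒∣ᵤ (≡[mod]⇒∣ a≡b)))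

≡[mod]⇒%ℕ≡ : ∀ {p x n} .{{_ : NonZero p}} → x ≡ + n [mod p ] → n < p → x %ℕ p ≡ n
≡[mod]⇒%ℕ≡ {p} {x} x≡n n<p =
  ≡[mod]⇒≡ (≡[mod]-trans (≡[mod]-sym x≡x%p) x≡n) (n%ℕd<d x p) n<p
  where
  x≡x%p : x ≡ + (x %ℕ p) [mod p ]
  x≡x%p = ∣⇒≡[mod] $ divides (x /ℕ p) $ begin
    x - + (x %ℕ p)                             ≡⟨ cong (_- + (x %ℕ p)) (a≡a%ℕn+[a/ℕn]*n x p) ⟩
    + (x %ℕ p) + (x /ℕ p) * + p - + (x %ℕ p)   ≡⟨ cancel (+ (x %ℕ p)) ((x /ℕ p) * + p) ⟩
    (x /ℕ p) * + p                             ∎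
    where
    open ≡-Reasoning
    cancel : ∀ r m → r + m - r ≡ m
    cancel = solve-∀

restrict : ∀ {P : ℕ → Set} {t} → (∀ i → 1 ≤ i → i ≤ suc t → P i) → ∀ i → 1 ≤ i → i ≤ t → P i
restrict h i 1≤i i≤t = h i 1≤i (ℕ.m≤n⇒m≤1+n i≤t)

sumℕ-mono-≤ : ∀ t {f g : ℕ → ℕ} → (∀ i → 1 ≤ i → i ≤ t → f i ≤ g i) → sumℕ t f ≤ sumℕ t g
sumℕ-mono-≤ zero    f≤g = ℕ.z≤n
sumℕ-mono-≤ (suc t) f≤g =
  ℕ.+-mono-≤ (sumℕ-mono-≤ t (restrict f≤g)) (f≤g (suc t) (ℕ.s≤s ℕ.z≤n) ℕ.≤-refl)

sumℕ-zero : ∀ t {f : ℕ → ℕ} → (∀ i → 1 ≤ i → i ≤ t → f i ≡ 0) → sumℕ t f ≡ 0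
sumℕ-zero zero    f≡0 = refl
sumℕ-zero (suc t) f≡0 =
  cong₂ ℕ._+_ (sumℕ-zero t (restrict f≡0)) (f≡0 (suc t) (ℕ.s≤s ℕ.z≤n) ℕ.≤-refl)

pos-sumℕ : ∀ t (f : ℕ → ℕ) → + sumℕ t f ≡ sumℤ t (λ i → + f i)
pos-sumℕ zero    f = refl
pos-sumℕ (suc t) f =
  trans (ℤ.pos-+ (sumℕ t f) (f (suc t))) (cong (_+ + f (suc t)) (pos-sumℕ t f))

*-distribˡ-sumℤ : ∀ c t (f : ℕ → ℤ) → c * sumℤ t f ≡ sumℤ t (λ i → c * f i)
*-distribˡ-sumℤ c zero    f = ℤ.*-zeroʳ c
*-distribˡ-sumℤ c (suc t) f =
  trans (ℤ.*-distribˡ-+ c (sumℤ t f) (f (suc t))) (cong (_+ c * f (suc t)) (*-distribˡ-sumℤ c t f))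

sumℤ-cong-mod : ∀ {p} t {f g : ℕ → ℤ} → (∀ i → 1 ≤ i → i ≤ t → f i ≡ g i [mod p ]) →
                sumℤ t f ≡ sumℤ t g [mod p ]
sumℤ-cong-mod zero    f≡g = ≡⇒≡[mod] refl
sumℤ-cong-mod (suc t) f≡g =
  +-cong-mod (sumℤ-cong-mod t (restrict f≡g)) (f≡g (suc t) (ℕ.s≤s ℕ.z≤n) ℕ.≤-refl)

sumℕ[Z*s]+1≡s[1+m]+s[m] : ∀ Z m →
  sumℕ m (λ i → Z i ℕ.* sSeq Z i) ℕ.+ 1 ≡ sSeq Z (suc m) ℕ.+ sSeq Z m
sumℕ[Z*s]+1≡s[1+m]+s[m] Z zero    = refl
sumℕ[Z*s]+1≡s[1+m]+s[m] Z (suc m) = begin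
  ∑Z ℕ.+ Z' ℕ.* s' ℕ.+ 1    ≡⟨ swap ∑Z (Z' ℕ.* s') ⟩
  ∑Z ℕ.+ 1 ℕ.+ Z' ℕ.* s'    ≡⟨ cong (ℕ._+ Z' ℕ.* s') (sumℕ[Z*s]+1≡s[1+m]+s[m] Z m) ⟩
  s' ℕ.+ s ℕ.+ Z' ℕ.* s'    ≡⟨ rotate s' s (Z' ℕ.* s') ⟩
  Z' ℕ.* s' ℕ.+ s ℕ.+ s'    ∎
  where
  open ≡-Reasoning
  ∑Z = sumℕ m (λ i → Z i ℕ.* sSeq Z i)
  Z' = Z (suc m)
  s' = sSeq Z (suc m)
  s = sSeq Z m
  swap : ∀ a b → a ℕ.+ b ℕ.+ 1 ≡ a ℕ.+ 1 ℕ.+ b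
  swap = ℕ-Solver.solve-∀
  rotate : ∀ a b c → a ℕ.+ b ℕ.+ c ≡ c ℕ.+ b ℕ.+ a
  rotate = ℕ-Solver.solve-∀

sumℕ[z*s]<s[1+t] : ∀ {Z z : ℕ → ℕ} t → (∀ i → 1 ≤ i → i ≤ t → z i ≤ Z i) → z t < Z t →
                   sumℕ t (λ i → z i ℕ.* sSeq Z i) < sSeq Z (suc t)
sumℕ[z*s]<s[1+t]         zero    z≤Z zₜ<Zₜ = ℕ.z<s
sumℕ[z*s]<s[1+t] {Z} {z} (suc m) z≤Z zₜ<Zₜ =
  ℕ.+-cancelʳ-≤ s' (suc (∑z ℕ.+ z' ℕ.* s')) (sSeq Z (suc (suc m))) $ begin
  suc (∑z ℕ.+ z' ℕ.* s') ℕ.+ s'    ≡⟨ regroup ∑z (z' ℕ.* s') s' ⟩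
  ∑z ℕ.+ suc z' ℕ.* s' ℕ.+ 1       ≤⟨ ℕ.+-monoˡ-≤ 1 (ℕ.+-mono-≤ ∑z≤∑Z (ℕ.*-monoˡ-≤ s' zₜ<Zₜ)) ⟩
  ∑Z ℕ.+ Z (suc m) ℕ.* s' ℕ.+ 1    ≡⟨ sumℕ[Z*s]+1≡s[1+m]+s[m] Z (suc m) ⟩
  sSeq Z (suc (suc m)) ℕ.+ s'      ∎
  where
  open ℕ.≤-Reasoning
  z' = z (suc m)
  s' = sSeq Z (suc m)
  ∑z = sumℕ m (λ i → z i ℕ.* sSeq Z i)
  ∑Z = sumℕ m (λ i → Z i ℕ.* sSeq Z i)
  ∑z≤∑Z : ∑z ≤ ∑Z
  ∑z≤∑Z = sumℕ-mono-≤ m (λ i 1≤i i≤m → ℕ.*-monoˡ-≤ (sSeq Z i) (restrict z≤Z i 1≤i i≤m))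
  regroup : ∀ a b c → suc (a ℕ.+ b) ℕ.+ c ≡ a ℕ.+ (c ℕ.+ b) ℕ.+ 1
  regroup = ℕ-Solver.solve-∀

pos-*+ : ∀ a b c → + (a ℕ.* b ℕ.+ c) ≡ + a * + b + + c
pos-*+ a b c = trans (ℤ.pos-+ (a ℕ.* b) c) (cong (_+ + c) (ℤ.pos-* a b))

module _ {Z r : ℕ → ℕ} {t : ℕ}
         (division : ∀ n → n < t → r n ≡ Z (suc n) ℕ.* r (suc n) ℕ.+ r (suc (suc n))) where

  r[n]*s[1+n]+r[1+n]*s[n]≡r₀ : ∀ n → n ≤ t → r n ℕ.* sSeq Z (suc n) ℕ.+ r (suc n) ℕ.* sSeq Z n ≡ r 0
  r[n]*s[1+n]+r[1+n]*s[n]≡r₀ zero    _   = unit (r 0) (r 1)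
    where
    unit : ∀ a b → a ℕ.* 1 ℕ.+ b ℕ.* 0 ≡ a
    unit = ℕ-Solver.solve-∀
  r[n]*s[1+n]+r[1+n]*s[n]≡r₀ (suc n) n<t = begin
    r₁ ℕ.* (Z₁ ℕ.* s₁ ℕ.+ s₀) ℕ.+ r₂ ℕ.* s₁  ≡⟨ exchange Z₁ r₁ r₂ s₀ s₁ ⟩
    (Z₁ ℕ.* r₁ ℕ.+ r₂) ℕ.* s₁ ℕ.+ r₁ ℕ.* s₀  ≡⟨ cong (λ a → a ℕ.* s₁ ℕ.+ r₁ ℕ.* s₀) (division n n<t) ⟨
    r n ℕ.* s₁ ℕ.+ r₁ ℕ.* s₀                 ≡⟨ r[n]*s[1+n]+r[1+n]*s[n]≡r₀ n (ℕ.<⇒≤ n<t) ⟩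
    r 0                                      ∎
    where
    open ≡-Reasoning
    Z₁ = Z (suc n)
    r₁ = r (suc n)
    r₂ = r (suc (suc n))
    s₀ = sSeq Z n
    s₁ = sSeq Z (suc n)
    exchange : ∀ Z r₁ r₂ s₀ s₁ →
      r₁ ℕ.* (Z ℕ.* s₁ ℕ.+ s₀) ℕ.+ r₂ ℕ.* s₁ ≡ (Z ℕ.* r₁ ℕ.+ r₂) ℕ.* s₁ ℕ.+ r₁ ℕ.* s₀
    exchange = ℕ-Solver.solve-∀

  -- Carrying the congruence for r n along makes the two-term recurrence a one-step induction.
  remainder≡continuant[mod] : ∀ {p} u → u * + r 0 ≡ 0ℤ [mod p ] → u * + r 1 ≡ 1ℤ [mod p ] →
    ∀ n → n ≤ t → u * -1ℤ ^ n * + r n ≡ - + sSeq Z n [mod p ]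
                × u * -1ℤ ^ n * + r (suc n) ≡ + sSeq Z (suc n) [mod p ]
  remainder≡continuant[mod] {p} u ur₀≡0 ur₁≡1 zero _ =
    subst (_≡ 0ℤ [mod p ]) (cong (_* + r 0) (sym (ℤ.*-identityʳ u))) ur₀≡0 ,
    subst (_≡ 1ℤ [mod p ]) (cong (_* + r 1) (sym (ℤ.*-identityʳ u))) ur₁≡1
  remainder≡continuant[mod] {p} u ur₀≡0 ur₁≡1 (suc n) n<t = odd , even
    where
    open ≡[mod]-Reasoning p
    ε = -1ℤ ^ n
    Z₁ = Z (suc n)
    s₀ = sSeq Z n
    s₁ = sSeq Z (suc n)
    induction-hypothesis = remainder≡continuant[mod] u ur₀≡0 ur₁≡1 n (ℕ.<⇒≤ n<t)
    odd : u * (-1ℤ * ε) * + r (suc n) ≡ - + s₁ [mod p ]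
    odd = begin
      u * (-1ℤ * ε) * + r (suc n)  ≡⟨ flip u ε (+ r (suc n)) ⟩
      - (u * ε * + r (suc n))      ≈⟨ neg-cong-mod (proj₂ induction-hypothesis) ⟩
      - + s₁                       ∎
      where
      flip : ∀ u e R → u * (-1ℤ * e) * R ≡ - (u * e * R)
      flip = solve-∀
    even : u * (-1ℤ * ε) * + r (suc (suc n)) ≡ + sSeq Z (suc (suc n)) [mod p ]
    even = begin
      u * (-1ℤ * ε) * R₂                        ≡⟨ expand u ε (+ Z₁) R₁ R₂ ⟩
      - (u * ε * (+ Z₁ * R₁ + R₂)) + + Z₁ * (u * ε * R₁)
                                                ≡⟨ cong (λ R → - (u * ε * R) + + Z₁ * (u * ε * R₁)) R₀≡ ⟨
      - (u * ε * + r n) + + Z₁ * (u * ε * R₁)   ≈⟨ +-cong-mod (neg-cong-mod (proj₁ induction-hypothesis))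
                                                              (*-congˡ-mod (+ Z₁) (proj₂ induction-hypothesis)) ⟩
      - - + s₀ + + Z₁ * + s₁                    ≡⟨ collect (+ s₀) (+ Z₁ * + s₁) ⟩
      + Z₁ * + s₁ + + s₀                        ≡⟨ pos-*+ Z₁ s₁ s₀ ⟨
      + sSeq Z (suc (suc n))                    ∎
      where
      R₁ = + r (suc n)
      R₂ = + r (suc (suc n))
      R₀≡ : + r n ≡ + Z₁ * R₁ + R₂
      R₀≡ = trans (cong +_ (division n n<t)) (pos-*+ Z₁ (r (suc n)) (r (suc (suc n))))
      expand : ∀ u e Z R₁ R₂ →
        u * (-1ℤ * e) * R₂ ≡ - (u * e * (Z * R₁ + R₂)) + Z * (u * e * R₁)
      expand = solve-∀
      collect : ∀ a b → - - a + b ≡ b + a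
      collect = solve-∀

  s[1+t]≡r₀ : r t ≡ 1 → r (suc t) ≡ 0 → sSeq Z (suc t) ≡ r 0
  s[1+t]≡r₀ rₜ≡1 rₜ₊₁≡0 = begin
    sₜ₊₁                                      ≡⟨ unit sₜ₊₁ sₜ ⟩
    1 ℕ.* sₜ₊₁ ℕ.+ 0 ℕ.* sₜ                   ≡⟨ cong₂ (λ a b → a ℕ.* sₜ₊₁ ℕ.+ b ℕ.* sₜ) rₜ≡1 rₜ₊₁≡0 ⟨
    r t ℕ.* sₜ₊₁ ℕ.+ r (suc t) ℕ.* sₜ         ≡⟨ r[n]*s[1+n]+r[1+n]*s[n]≡r₀ t ℕ.≤-refl ⟩
    r 0                                       ∎
    where
    open ≡-Reasoning
    sₜ = sSeq Z t
    sₜ₊₁ = sSeq Z (suc t)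
    unit : ∀ a b → a ≡ 1 ℕ.* a ℕ.+ 0 ℕ.* b
    unit = ℕ-Solver.solve-∀

  alternating-sum≡continuant-sum[mod] : ∀ {p} u → u * + r 0 ≡ 0ℤ [mod p ] → u * + r 1 ≡ 1ℤ [mod p ] →
    ∀ (z : ℕ → ℕ) → u * sumℤ t (λ i → + z i * -1ℤ ^ ℕ.pred i * + r i)
                    ≡ + sumℕ t (λ i → z i ℕ.* sSeq Z i) [mod p ]
  alternating-sum≡continuant-sum[mod] {p} u ur₀≡0 ur₁≡1 z = begin
    u * sumℤ t (λ i → + z i * -1ℤ ^ ℕ.pred i * + r i)    ≡⟨ *-distribˡ-sumℤ u t _ ⟩
    sumℤ t (λ i → u * (+ z i * -1ℤ ^ ℕ.pred i * + r i))  ≈⟨ sumℤ-cong-mod t termwise ⟩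
    sumℤ t (λ i → + (z i ℕ.* sSeq Z i))                  ≡⟨ pos-sumℕ t _ ⟨
    + sumℕ t (λ i → z i ℕ.* sSeq Z i)                    ∎
    where
    open ≡[mod]-Reasoning p
    termwise : ∀ i → 1 ≤ i → i ≤ t →
      u * (+ z i * -1ℤ ^ ℕ.pred i * + r i) ≡ + (z i ℕ.* sSeq Z i) [mod p ]
    termwise (suc n) _ n<t = begin
      u * (+ zₙ₊₁ * -1ℤ ^ n * + r (suc n))  ≡⟨ commute u (+ zₙ₊₁) (-1ℤ ^ n) (+ r (suc n)) ⟩
      + zₙ₊₁ * (u * -1ℤ ^ n * + r (suc n))  ≈⟨ *-congˡ-mod (+ zₙ₊₁) (proj₂ remainderₙ₊₁) ⟩
      + zₙ₊₁ * + sSeq Z (suc n)             ≡⟨ ℤ.pos-* zₙ₊₁ (sSeq Z (suc n)) ⟨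
      + (zₙ₊₁ ℕ.* sSeq Z (suc n))           ∎
      where
      zₙ₊₁ = z (suc n)
      remainderₙ₊₁ = remainder≡continuant[mod] u ur₀≡0 ur₁≡1 n (ℕ.<⇒≤ n<t)
      commute : ∀ u z e R → u * (z * e * R) ≡ z * (u * e * R)
      commute = solve-∀

lemma7 : (p : ℕ) .{{_ : NonZero p}} → 3 ≤ p →
    (u : ℤ) → Coprime ∣ u ∣ p →
    (r₁ : ℕ) → 0 < r₁ → r₁ < p → (+ p) ∣ (u ℤ.* (+ r₁) ℤ.- + 1) →
    (t : ℕ) (Z r : ℕ → ℕ) →
    r 0 ≡ p → r 1 ≡ r₁ →
    (∀ i → 1 ≤ i → i ≤ t → (r (ℕ.pred i) ≡ Z i ℕ.* r i ℕ.+ r (suc i)) × r (suc i) < r i) →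
    1 ≤ t → r t ≡ 1 →
    (z : ℕ → ℕ) →
    (∀ i → 1 ≤ i → i ≤ t → z i ≤ Z i) →
    ((∀ i → 1 ≤ i → i ≤ t → z i ≡ 0)
      ⊎ ((Σ ℕ λ i → 1 ≤ i × i ≤ t × 0 < z i × i % 2 ≡ 1 × (∀ j → 1 ≤ j → j < i → z j ≡ 0))
         × suc (z t) ≤ Z t)) →
    (u ℤ.* sumℤ t (λ i → + (z i) ℤ.* ((- + 1) ℤ.^ ℕ.pred i) ℤ.* + (r i))) %ℕ p
      ≡ sumℕ t (λ i → z i ℕ.* sSeq Z i)
lemma7 p _ u _ r₁ _ _ p∣ur₁-1 t Z r r₀≡p r1≡r₁ euclid 1≤t rₜ≡1 z z≤Z z∈𝒵 =
  ≡[mod]⇒%ℕ≡ (alternating-sum≡continuant-sum[mod] division u ur₀≡0 ur₁≡1 z) bound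
  where
  division : ∀ n → n < t → r n ≡ Z (suc n) ℕ.* r (suc n) ℕ.+ r (suc (suc n))
  division n = proj₁ ∘ euclid (suc n) (ℕ.s≤s ℕ.z≤n)
  ur₀≡0 : u * + r 0 ≡ 0ℤ [mod p ]
  ur₀≡0 = ∣⇒≡[mod] (divides u (trans (ℤ.+-identityʳ _) (cong (λ a → u * + a) r₀≡p)))
  ur₁≡1 : u * + r 1 ≡ 1ℤ [mod p ]
  ur₁≡1 = subst (λ a → u * + a ≡ 1ℤ [mod p ]) (sym r1≡r₁) (∣⇒≡[mod] (∣ᵤ⇒∣ p∣ur₁-1))
  rₜ₊₁≡0 : r (suc t) ≡ 0
  rₜ₊₁≡0 = ℕ.n<1⇒n≡0 (subst (r (suc t) <_) rₜ≡1 (proj₂ (euclid t 1≤t ℕ.≤-refl)))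
  sₜ₊₁≡p : sSeq Z (suc t) ≡ p
  sₜ₊₁≡p = trans (s[1+t]≡r₀ division rₜ≡1 rₜ₊₁≡0) r₀≡p
  bound : sumℕ t (λ i → z i ℕ.* sSeq Z i) < p
  bound = [ (λ z≡0 → subst (_< p) (sym (sumℕ-zero t (λ i 1≤i i≤t → cong (ℕ._* sSeq Z i) (z≡0 i 1≤i i≤t))))
                                  (ℕ.>-nonZero⁻¹ p))
          , (λ (_ , zₜ<Zₜ) → subst (_ <_) sₜ₊₁≡p (sumℕ[z*s]<s[1+t] t z≤Z zₜ<Zₜ))
          ]′ z∈𝒵
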